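{- Let $G$ be a connected graph and let $A, B$ be two linked, disjoint and saturated subsets of $V(G)$. Then $\mathrm{mfs}(A,B) = \{\{u,v\} \subseteq V(G)\setminus(A\cup B) : \mathrm{cl}(\{u,v\})\cap N(A\cup B) \text{ is not a clique}\}.$ In particular, a set $X \subseteq V(G)\setminus(A\cup B)$ is forbidden if and only if it includes a pair belonging to $\mathrm{mfs}(A,B)$.
   Context: All graphs are finite, undirected and loopless. For $X\subseteq V(G)$, $N(X)=\{u\in V(G)\setminus X : u\text{ adjacent to some }x\in X\}$. A chordless $uv$-path is a $uv$-path that is an induced subgraph. A set $C$ is convex if for all $u,v\in C$ every vertex on a chordless $uv$-path lies in $C$; $\mathrm{cl}(X)$ is the intersection of all convex sets containing $X$. $A,B$ are linked if some vertex of $A$ is adjacent to some vertex of $B$. $A/B=\{v : \mathrm{cl}(B\cup\{v\})\cap A\ne\emptyset\}$. A set $X\subseteq V(G)\setminus(A\cup B)$ is forbidden if $\mathrm{cl}(X)\cap A\neq\emptyset$ and $\mathrm{cl}(X)\cap B\ne\emptyset$; $\mathrm{mfs}(A,B)$ is the family of inclusion-wise minimal forbidden sets. $\sigma(A,B)=\mathrm{cl}\big(A/B\cup\bigcup\{\bigcap_{x\in X}\mathrm{cl}(A\cup\{x\}) : X\in\mathrm{mfs}(A,B)\}\big)$; $S(A,B)=\bigcup_{i\ge0}\sigma(A_i,B_i)$ with $A_0=A$, $B_0=B$, $A_i=\sigma(A_{i-1},B_{i-1})$, $B_i=\sigma(B_{i-1},A_{i-1})$; $A,B$ are saturated if $A=S(A,B)$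 and $B=S(B,A)$. -}

module Defs where

open import Data.Nat using (ℕ; zero; suc)
open import Data.Bool using (Bool; true; false; T)
open import Data.Fin using (Fin; zero; suc; toℕ; inject₁; fromℕ)
open import Data.Fin.Subset using (Subset; _∈_; _∉_; _⊆_; _⊂_; _∪_; _∩_; ⁅_⁆; ∁; Empty)
open import Data.Product using (Σ; ∃; _×_; _,_; proj₁; proj₂)
open import Data.Sum using (_⊎_)
open import Relation.Nullary using (¬_)
open import Relation.Binary.PropositionalEquality using (_≡_; _≢_)
open import Function.Bundles using (_⇔_)

record Graph (n : ℕ) : Set where
  field
    adj   : Fin n → Fin n → Bool
    sym   : ∀ u v → adj u v ≡ adj v u
    irrefl : ∀ v → adj v v ≡ false

VSet : ℕ → Set₁
VSet n = Fin n → Set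

⟦_⟧ : ∀ {n} → Subset n → VSet n
⟦ X ⟧ v = v ∈ X

module _ {n : ℕ} (G : Graph n) where
  open Graph G

  Adjacent : Fin n → Fin n → Set
  Adjacent u v = T (adj u v)

  record Path (u v : Fin n) : Set where
    field
      len   : ℕ
      vert  : Fin (suc len) → Fin n
      start : vert zero ≡ u
      end   : vert (fromℕ len) ≡ v
      step  : ∀ (i : Fin len) → Adjacent (vert (inject₁ i)) (vert (suc i))

  record ChordlessPath (u v : Fin n) : Set where
    field
      len   : ℕ
      vert  : Fin (suc len) → Fin n
      start : vert zero ≡ u
      end   : vert (fromℕ len) ≡ v
      inj   : ∀ i j → vert i ≡ vert j → i ≡ j
      induced : ∀ i j → Adjacent (vert i) (vert j)
                  ⇔ (toℕ i ≡ suc (toℕ j) ⊎ toℕ j ≡ suc (toℕ i))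

  Connected : Set
  Connected = ∀ u v → Path u v

  Convex : Subset n → Set
  Convex C = ∀ u v → u ∈ C → v ∈ C → (P : ChordlessPath u v) →
             ∀ i → ChordlessPath.vert P i ∈ C

  cl : VSet n → VSet n
  cl X v = ∀ (C : Subset n) → Convex C → (∀ x → X x → x ∈ C) → v ∈ C

  N : VSet n → VSet n
  N X u = ¬ X u × ∃ λ x → X x × Adjacent u x

  Clique : VSet n → Set
  Clique K = ∀ x y → K x → K y → x ≢ y → Adjacent x y

  Linked : VSet n → VSet n → Set
  Linked A B = ∃ λ a → ∃ λ b → A a × B b × Adjacent a b

  Disjoint : VSet n → VSet n → Set
  Disjoint A B = ∀ v → A v → B v → ⊥'
    where open import Data.Empty renaming (⊥ to ⊥')

  _∪′_ : VSet n → VSet n → VSet n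
  (A ∪′ B) v = A v ⊎ B v

  _/_ : VSet n → VSet n → VSet n
  (A / B) v = ∃ λ a → A a × cl (B ∪′ (λ w → w ≡ v)) a

  Forbidden : VSet n → VSet n → Subset n → Set
  Forbidden A B X =
    (∀ x → x ∈ X → ¬ A x × ¬ B x) ×
    (∃ λ a → A a × cl ⟦ X ⟧ a) × (∃ λ b → B b × cl ⟦ X ⟧ b)

  MFS : VSet n → VSet n → Subset n → Set
  MFS A B X = Forbidden A B X × (∀ Y → Y ⊂ X → ¬ Forbidden A B Y)

  σ : VSet n → VSet n → VSet n
  σ A B = cl (λ w → (A / B) w ⊎
                    (∃ λ X → MFS A B X × (∀ x → x ∈ X → cl (A ∪′ (λ y → y ≡ x)) w)))

  iter : VSet n → VSet n → ℕ → VSet n × VSet n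
  iter A B zero = A , B
  iter A B (suc i) with iter A B i
  ... | Ai , Bi = σ Ai Bi , σ Bi Ai

  S : VSet n → VSet n → VSet n
  S A B v = ∃ λ i → σ (proj₁ (iter A B i)) (proj₂ (iter A B i)) v

  Saturated : VSet n → VSet n → Set
  Saturated A B = (∀ v → A v ⇔ S A B v) × (∀ v → B v ⇔ S B A v)

{-# OPTIONS --safe #-}
-- Saturation makes A and B convex with A/B ⊆ A and B/A ⊆ B. Hence every vertex x of N(A ∪ B) has
-- neighbours on both sides: otherwise an induced path from x through A to a vertex of B adjacent to A
-- would put a vertex of A into cl(B ∪ {x}). So two distinct non-adjacent vertices of N(A ∪ B) have
-- vertices of both A and B in their hull, and a pair {u, v} whose hull meets N(A ∪ B) in a non-clique
-- is forbidden, and minimal because singletons are convex. Conversely, if cl{u, v} meets A ∪ B, then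
-- cl{u, v} ∖ (A ∪ B) is not convex, and an induced path leaving and re-entering it starts and ends at
-- two non-adjacent vertices of N(A ∪ B).
--
-- It remains to show that every forbidden set X contains a pair whose hull meets A. Around each x ∈ X
-- take its cell, the vertices reachable from x through vertices outside A ∪ B without neighbours in
-- A ∪ B, and its attachments, the vertices of N(A ∪ B) equal or adjacent to the cell. The attachments
-- of one x form a clique (else A would meet cl(B ∪ {x})), and an attachment of x not adjacent to an
-- attachment of y lies in cl{x, y}. Hence, if no pair of X has a hull meeting A, the union of all
-- cells and attachments is convex; it contains X and misses A, and therefore so does cl X.
module Submission where

open import Defs
open import Data.Nat using (ℕ; zero; suc; _+_; _∸_; _≤_; _<_; z≤n; s≤s; _<?_)
open import Data.Nat.Properties
  using (≤-refl; ≤-trans; <⇒≤; <⇒≢; <⇒≱; ≤∧≢⇒<; ≰⇒>; ≤-pred; m≤n⇒m≤1+n; m≤n⇒m<n∨m≡n;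
         m≤m+n; m≤n+m; m<m+n; +-identityʳ; +-suc; +-cancelˡ-≡; m+[n∸m]≡n; +-monoʳ-≤; +-monoʳ-<)
open import Data.Bool using (true; T)
open import Data.Bool.Properties using (T?)
open import Data.Fin using (Fin; toℕ; fromℕ; fromℕ<; inject₁) renaming (zero to fzero; suc to fsuc)
open import Data.Fin.Properties using (toℕ-injective; toℕ-fromℕ; toℕ-fromℕ<; toℕ<n; any?; all?; pigeonhole)
  renaming (_≟_ to _≟ᶠ_)
open import Data.Fin.Subset using (Subset; _∈_; _∉_; _⊆_; _⊂_; _∪_; ⁅_⁆; ∁)
open import Data.Fin.Subset.Properties
  using (_∈?_; anySubset?; x∈p∪q⁻; x∈p∪q⁺; x∈⁅x⁆; x∈⁅y⁆⇒x≡y; ⊆-antisym; x∈∁p⇒x∉p)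
open import Data.Vec using (tabulate)
open import Data.Vec.Properties using (lookup∘tabulate; []=⇒lookup; lookup⇒[]=)
open import Data.Product using (∃; ∃₂; _×_; _,_; proj₁; proj₂)
open import Data.Sum using (_⊎_; inj₁; inj₂; [_,_]′)
open import Data.Unit using (⊤; tt)
open import Function using (_∘_)
open import Relation.Nullary using (¬_; Dec; yes; no; does; contradiction)
open import Relation.Nullary.Decidable using (_×-dec_; _⊎-dec_; _→-dec_; ¬?; map′; decidable-stable)
open import Relation.Unary using (Decidable)
open import Relation.Binary.PropositionalEquality using (_≡_; _≢_; refl; sym; trans; cong; subst; subst₂)
open import Function.Bundles using (_⇔_; mk⇔; Equivalence)

module _ {P : ℕ → Set} (P? : ∀ i → Dec (P i)) where

  last-satisfying : ∀ L → P 0 → ∃ λ j → j ≤ L × P j × (∀ k → j < k → k ≤ L → ¬ P k)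
  last-satisfying zero p₀ = 0 , z≤n , p₀ , λ k 0<k k≤0 → contradiction k≤0 (<⇒≱ 0<k)
  last-satisfying (suc L) p₀ with P? (suc L) | last-satisfying L p₀
  ... | yes p | _ = suc L , ≤-refl , p , λ k L<k k≤L → contradiction k≤L (<⇒≱ L<k)
  ... | no ¬p | j , j≤L , pj , none = j , m≤n⇒m≤1+n j≤L , pj , none′
    where
      none′ : ∀ k → j < k → k ≤ suc L → ¬ P k
      none′ k j<k k≤1+L with m≤n⇒m<n∨m≡n k≤1+L
      ... | inj₁ k<1+L = none k j<k (≤-pred k<1+L)
      ... | inj₂ refl  = ¬p

  first-satisfying : ∀ k d → P (k + d) →
                     ∃ λ b → k ≤ b × b ≤ k + d × P b × (∀ i → k ≤ i → i < b → ¬ P i)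
  first-satisfying k d pk+d with P? k
  ... | yes pk = k , ≤-refl , m≤m+n k d , pk , λ i k≤i i<k → contradiction k≤i (<⇒≱ i<k)
  first-satisfying k zero pk | no ¬pk = contradiction (subst P (+-identityʳ k) pk) ¬pk
  first-satisfying k (suc d) pk+d | no ¬pk
    with first-satisfying (suc k) d (subst P (+-suc k d) pk+d)
  ... | b , k<b , b≤ , pb , none = b , <⇒≤ k<b , subst (b ≤_) (sym (+-suc k d)) b≤ , pb , none′
    where
      none′ : ∀ i → k ≤ i → i < b → ¬ P i
      none′ i k≤i i<b with m≤n⇒m<n∨m≡n k≤i
      ... | inj₁ k<i = none i k<i i<b
      ... | inj₂ refl = ¬pk

  crossing : ∀ {L} → P 0 → ¬ P L → ∃ λ a → suc a ≤ L × P a × ¬ P (suc a)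
  crossing {L} p₀ ¬pL with last-satisfying L p₀
  ... | a , a≤L , pa , after-a = a , a<L , pa , after-a (suc a) ≤-refl a<L
    where a<L = ≤∧≢⇒< a≤L λ { refl → ¬pL pa }

  gap : ∀ {k L} → P 0 → P L → k ≤ L → ¬ P k →
        ∃₂ λ a b → suc a ≤ b × suc b ≤ L × P a × P (suc b) × (∀ t → suc a ≤ t → t ≤ b → ¬ P t)
  gap {L = L} p₀ pL k≤L ¬pk with crossing p₀ ¬pk
  ... | a , a<k , pa , ¬pa+1 with ≤-trans a<k k≤L
  ... | a<L with first-satisfying (suc a) (L ∸ suc a) (subst P (sym (m+[n∸m]≡n a<L)) pL)
  ... | zero , () , _
  ... | suc b , a+1≤b+1 , b+1≤ , pb+1 , before-b =
    a , b , a+1≤b , subst (suc b ≤_) (m+[n∸m]≡n a<L) b+1≤ , pa , pb+1 ,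
    λ t a+1≤t t≤b → before-b t a+1≤t (s≤s t≤b)
    where
      a+1≤b : suc a ≤ b
      a+1≤b = ≤-pred (≤∧≢⇒< a+1≤b+1 λ { refl → ¬pa+1 pb+1 })

module _ {n : ℕ} {P : Fin n → Set} (P? : Decidable P) where

  subset : Subset n
  subset = tabulate (does ∘ P?)

  ∈-subset⁺ : ∀ {i} → P i → i ∈ subset
  ∈-subset⁺ {i} p = lookup⇒[]= i subset (trans (lookup∘tabulate _ i) (holds (P? i)))
    where
      holds : (d : Dec (P i)) → does d ≡ true
      holds (yes _) = refl
      holds (no ¬p) = contradiction p ¬p

  ∈-subset⁻ : ∀ {i} → i ∈ subset → P i
  ∈-subset⁻ {i} i∈ = holds (P? i) (trans (sym (lookup∘tabulate _ i)) ([]=⇒lookup i∈))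
    where
      holds : (d : Dec (P i)) → does d ≡ true → P i
      holds (yes p) _ = p
      holds (no _) ()

clamp : ∀ L → ℕ → Fin (suc L)
clamp L       zero    = fzero
clamp zero    (suc k) = fzero
clamp (suc L) (suc k) = fsuc (clamp L k)

toℕ-clamp : ∀ {L k} → k ≤ L → toℕ (clamp L k) ≡ k
toℕ-clamp {L}     {zero}  _         = refl
toℕ-clamp {suc L} {suc k} (s≤s k≤L) = cong suc (toℕ-clamp k≤L)

clamp-toℕ : ∀ {L} (i : Fin (suc L)) → clamp L (toℕ i) ≡ i
clamp-toℕ i = toℕ-injective (toℕ-clamp (≤-pred (toℕ<n i)))

module _ {n : ℕ} (G : Graph n) where
  open Graph G using (adj; irrefl) renaming (sym to adj-comm)

  Adj : Fin n → Fin n → Set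
  Adj = Adjacent G

  adj? : ∀ u v → Dec (Adj u v)
  adj? u v = T? (adj u v)

  adj-sym : ∀ {u v} → Adj u v → Adj v u
  adj-sym {u} {v} = subst T (adj-comm u v)

  adj⇒≢ : ∀ {u v} → Adj u v → u ≢ v
  adj⇒≢ {v = v} u∼v refl = subst T (irrefl v) u∼v

  -- Walks and induced paths

  data Walk (U : Fin n → Set) : Fin n → Fin n → ℕ → Set where
    stop : ∀ {u} → U u → Walk U u u zero
    step : ∀ {u w v k} → U u → Adj u w → Walk U w v k → Walk U u v (suc k)

  Reach : (Fin n → Set) → Fin n → Fin n → Set
  Reach U u v = ∃ (Walk U u v)

  module _ {U : Fin n → Set} where

    walk-head : ∀ {u v k} → Walk U u v k → U u
    walk-head (stop p)     = p
    walk-head (step p _ _) = p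

    walk-last : ∀ {u v k} → Walk U u v k → U v
    walk-last (stop p)     = p
    walk-last (step _ _ w) = walk-last w

    walk-snoc : ∀ {u w v k} → Walk U u w k → Adj w v → U v → Walk U u v (suc k)
    walk-snoc (stop p)       w∼v q = step p w∼v (stop q)
    walk-snoc (step p u∼ w) w∼v q = step p u∼ (walk-snoc w w∼v q)

    walk-++ : ∀ {u w v k l} → Walk U u w k → Walk U w v l → Walk U u v (k + l)
    walk-++ (stop _)       w′ = w′
    walk-++ (step p u∼ w) w′ = step p u∼ (walk-++ w w′)

    walk-reverse : ∀ {u v k} → Walk U u v k → Walk U v u k
    walk-reverse (stop p)       = stop p
    walk-reverse (step p u∼ w) = walk-snoc (walk-reverse w) (adj-sym u∼) p

    reach-here : ∀ {u} → U u → Reach U u u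
    reach-here p = 0 , stop p

    reach-cons : ∀ {u w v} → U u → Adj u w → Reach U w v → Reach U u v
    reach-cons p u∼w (k , w) = suc k , step p u∼w w

    reach-snoc : ∀ {u w v} → Reach U u w → Adj w v → U v → Reach U u v
    reach-snoc (k , w) w∼v q = suc k , walk-snoc w w∼v q

    reach-++ : ∀ {u w v} → Reach U u w → Reach U w v → Reach U u v
    reach-++ (k , w) (l , w′) = k + l , walk-++ w w′

    reach-reverse : ∀ {u v} → Reach U u v → Reach U v u
    reach-reverse (k , w) = k , walk-reverse w

    reach-head : ∀ {u v} → Reach U u v → U u
    reach-head (_ , w) = walk-head w

    reach-last : ∀ {u v} → Reach U u v → U v
    reach-last (_ , w) = walk-last w

  walk-map : ∀ {U V : Fin n → Set} {u v k} → (∀ {x} → U x → V x) → Walk U u v k → Walk V u v k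
  walk-map f (stop p)       = stop (f p)
  walk-map f (step p u∼ w) = step (f p) u∼ (walk-map f w)

  reach-map : ∀ {U V : Fin n → Set} {u v} → (∀ {x} → U x → V x) → Reach U u v → Reach V u v
  reach-map f (k , w) = k , walk-map f w

  reach-along : ∀ {U : Fin n → Set} {u v} → Reach U u v → Reach (Reach U u) u v
  reach-along {U} {u} (k , w) = k , along (stop (walk-head w)) w
    where
      along : ∀ {x y k l} → Walk U u x l → Walk U x y k → Walk (Reach U u) x y k
      along w₀ (stop p)       = stop (_ , w₀)
      along w₀ (step p x∼ w) = step (_ , w₀) x∼ (along (walk-snoc w₀ x∼ (walk-head w)) w)

  -- Vertices are indexed by ℕ; only the values at indices ≤ len matter.
  record InducedPath (U : Fin n → Set) (u v : Fin n) : Set where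
    field
      len       : ℕ
      vert      : ℕ → Fin n
      start     : vert 0 ≡ u
      end       : vert len ≡ v
      inside    : ∀ i → i ≤ len → U (vert i)
      injective : ∀ {i j} → i ≤ len → j ≤ len → vert i ≡ vert j → i ≡ j
      chordless : ∀ {i j} → i ≤ len → j ≤ len → Adj (vert i) (vert j) → i ≡ suc j ⊎ j ≡ suc i
      edge      : ∀ i → i < len → Adj (vert i) (vert (suc i))

  open InducedPath

  module _ {U : Fin n → Set} where

    trivial-path : ∀ {u} → U u → InducedPath U u u
    trivial-path {u} p = record
      { len = 0 ; vert = λ _ → u ; start = refl ; end = refl ; inside = λ _ _ → p
      ; injective = λ { z≤n z≤n _ → refl } ; chordless = λ _ _ u∼u → contradiction refl (adj⇒≢ u∼u)
      ; edge = λ _ () }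

    suffix : ∀ {u v} (q : InducedPath U u v) j → j ≤ len q → InducedPath U (vert q j) v
    suffix q j j≤len = record
      { len = len q ∸ j ; vert = λ i → vert q (j + i)
      ; start = cong (vert q) (+-identityʳ j)
      ; end = trans (cong (vert q) (m+[n∸m]≡n j≤len)) (end q)
      ; inside = λ i i≤ → inside q (j + i) (shift i≤)
      ; injective = λ i≤ i′≤ eq → +-cancelˡ-≡ j _ _ (injective q (shift i≤) (shift i′≤) eq)
      ; chordless = λ i≤ i′≤ a → unshift (chordless q (shift i≤) (shift i′≤) a)
      ; edge = λ i i< → subst (Adj (vert q (j + i)) ∘ vert q) (sym (+-suc j i))
                              (edge q (j + i) (subst (_≤ len q) (+-suc j i) (shift i<)))
      }
      where
        shift : ∀ {i} → i ≤ len q ∸ j → j + i ≤ len q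
        shift i≤ = subst (_ ≤_) (m+[n∸m]≡n j≤len) (+-monoʳ-≤ j i≤)
        unshift : ∀ {i i′} → j + i ≡ suc (j + i′) ⊎ j + i′ ≡ suc (j + i) → i ≡ suc i′ ⊎ i′ ≡ suc i
        unshift {i} {i′} (inj₁ eq) = inj₁ (+-cancelˡ-≡ j i (suc i′) (trans eq (sym (+-suc j i′))))
        unshift {i} {i′} (inj₂ eq) = inj₂ (+-cancelˡ-≡ j i′ (suc i) (trans eq (sym (+-suc j i))))

    cons : ∀ {x w v} (q : InducedPath U w v) → U x → Adj x w →
           (∀ i → i ≤ len q → x ≢ vert q i) → (∀ i → 0 < i → i ≤ len q → ¬ Adj x (vert q i)) →
           InducedPath U x v
    cons {x} q ux x∼w x∉q x≁q = record
      { len = suc (len q) ; vert = vert′ ; start = refl ; end = end q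
      ; inside = inside′ ; injective = injective′ ; chordless = chordless′ ; edge = edge′ }
      where
        vert′ : ℕ → Fin n
        vert′ zero    = x
        vert′ (suc i) = vert q i
        inside′ : ∀ i → i ≤ suc (len q) → U (vert′ i)
        inside′ zero    _          = ux
        inside′ (suc i) (s≤s i≤) = inside q i i≤
        injective′ : ∀ {i j} → i ≤ suc (len q) → j ≤ suc (len q) → vert′ i ≡ vert′ j → i ≡ j
        injective′ {zero}  {zero}  _          _          _  = refl
        injective′ {zero}  {suc j} _          (s≤s j≤) eq = contradiction eq (x∉q j j≤)
        injective′ {suc i} {zero}  (s≤s i≤) _          eq = contradiction (sym eq) (x∉q i i≤)
        injective′ {suc i} {suc j} (s≤s i≤) (s≤s j≤) eq = cong suc (injective q i≤ j≤ eq)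
        only-first : ∀ {j} → j ≤ len q → Adj x (vert q j) → suc j ≡ 1
        only-first {zero}  _  _   = refl
        only-first {suc j} j≤ x∼ = contradiction x∼ (x≁q (suc j) (s≤s z≤n) j≤)
        chordless′ : ∀ {i j} → i ≤ suc (len q) → j ≤ suc (len q) → Adj (vert′ i) (vert′ j) →
                     i ≡ suc j ⊎ j ≡ suc i
        chordless′ {zero}  {zero}  _          _          x∼x = contradiction refl (adj⇒≢ x∼x)
        chordless′ {zero}  {suc j} _          (s≤s j≤) x∼ = inj₂ (only-first j≤ x∼)
        chordless′ {suc i} {zero}  (s≤s i≤) _          ∼x = inj₁ (only-first i≤ (adj-sym ∼x))
        chordless′ {suc i} {suc j} (s≤s i≤) (s≤s j≤) a  =
          [ inj₁ ∘ cong suc , inj₂ ∘ cong suc ]′ (chordless q i≤ j≤ a)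
        edge′ : ∀ i → i < suc (len q) → Adj (vert′ i) (vert′ (suc i))
        edge′ zero    _          = subst (Adj x) (sym (start q)) x∼w
        edge′ (suc i) (s≤s i<) = edge q i i<

    -- Shortcut to the last vertex of q that equals or is adjacent to the new first vertex.
    prepend : ∀ {x w v} → InducedPath U w v → U x → Adj x w → InducedPath U x v
    prepend {x} {v = v} q ux x∼w
      with last-satisfying (λ j → (x ≟ᶠ vert q j) ⊎-dec adj? x (vert q j)) (len q)
                           (inj₂ (subst (Adj x) (sym (start q)) x∼w))
    ... | j , j≤ , inj₁ x≡ , _    = subst (λ z → InducedPath U z v) (sym x≡) (suffix q j j≤)
    ... | j , j≤ , inj₂ x∼ , none = cons (suffix q j j≤) ux x∼ x∉ x≁
      where
        beyond : ∀ {i} → 0 < i → i ≤ len q ∸ j → ¬ (x ≡ vert q (j + i) ⊎ Adj x (vert q (j + i)))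
        beyond {i} 0<i i≤ = none (j + i) (subst (_< j + i) (+-identityʳ j) (+-monoʳ-< j 0<i))
                                 (subst (_ ≤_) (m+[n∸m]≡n j≤) (+-monoʳ-≤ j i≤))
        x∉ : ∀ i → i ≤ len q ∸ j → x ≢ vert q (j + i)
        x∉ zero    _  x≡ = adj⇒≢ x∼ (trans x≡ (cong (vert q) (+-identityʳ j)))
        x∉ (suc i) i≤ x≡ = beyond (s≤s z≤n) i≤ (inj₁ x≡)
        x≁ : ∀ i → 0 < i → i ≤ len q ∸ j → ¬ Adj x (vert q (j + i))
        x≁ i 0<i i≤ = beyond 0<i i≤ ∘ inj₂

    walk⇒path : ∀ {u v k} → Walk U u v k → InducedPath U u v
    walk⇒path (stop p)       = trivial-path p
    walk⇒path (step p u∼ w) = prepend (walk⇒path w) p u∼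

    reach⇒path : ∀ {u v} → Reach U u v → InducedPath U u v
    reach⇒path (_ , w) = walk⇒path w

    segment : ∀ {V : Fin n → Set} {u v} (q : InducedPath U u v) {i j} → i ≤ j → j ≤ len q →
              (∀ t → i ≤ t → t ≤ j → V (vert q t)) → Walk V (vert q i) (vert q j) (j ∸ i)
    segment {V} q {i} {j} i≤j j≤ inV =
      subst (λ t → Walk V (vert q i) (vert q t) (j ∸ i)) (m+[n∸m]≡n i≤j)
            (go i (j ∸ i) (subst (_≤ len q) (sym (m+[n∸m]≡n i≤j)) j≤)
                (λ t i≤t t≤ → inV t i≤t (subst (t ≤_) (m+[n∸m]≡n i≤j) t≤)))
      where
        go : ∀ i d → i + d ≤ len q → (∀ t → i ≤ t → t ≤ i + d → V (vert q t)) →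
             Walk V (vert q i) (vert q (i + d)) d
        go i zero _ inV′ =
          subst (λ t → Walk V (vert q i) (vert q t) 0) (sym (+-identityʳ i)) (stop (inV′ i ≤-refl (m≤m+n i 0)))
        go i (suc d) i+d≤ inV′ =
          step (inV′ i ≤-refl (m≤m+n i (suc d))) (edge q i (≤-trans (m<m+n i (s≤s z≤n)) i+d≤))
               (subst (λ t → Walk V (vert q (suc i)) (vert q t) d) (sym (+-suc i d))
                 (go (suc i) d (subst (_≤ len q) (+-suc i d) i+d≤)
                   (λ t i<t t≤ → inV′ t (<⇒≤ i<t) (subst (t ≤_) (sym (+-suc i d)) t≤))))

    path⇒reach : ∀ {V : Fin n → Set} {u v} (q : InducedPath U u v) →
                 (∀ i → i ≤ len q → V (vert q i)) → Reach V u v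
    path⇒reach {V} q inV = len q , subst₂ (λ a b → Walk V a b (len q)) (start q) (end q)
                                          (segment q z≤n ≤-refl (λ t _ → inV t))

    len<n : ∀ {u v} (q : InducedPath U u v) → len q < n
    len<n q with len q <? n
    ... | yes len<n = len<n
    ... | no len≮n with pigeonhole (≰⇒> len≮n) (vert q ∘ toℕ)
    ... | i , j , i<j , eq =
      contradiction (injective q (bound i) (bound j) eq) (<⇒≢ i<j)
      where
        bound : (i : Fin (suc (len q))) → toℕ i ≤ len q
        bound i = ≤-pred (toℕ<n i)

    nonadjacent-ends⇒2≤len : ∀ {u v} (q : InducedPath U u v) → u ≢ v → ¬ Adj u v → 2 ≤ len q
    nonadjacent-ends⇒2≤len q u≢v u≁v with len q | end q | edge q
    ... | zero        | end₀ | _     = contradiction (trans (sym (start q)) end₀) u≢v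
    ... | suc zero    | end₁ | edge₁ = contradiction (subst₂ Adj (start q) end₁ (edge₁ 0 (s≤s z≤n))) u≁v
    ... | suc (suc _) | _    | _     = s≤s (s≤s z≤n)

    far-apart : ∀ {u v} (q : InducedPath U u v) {a b} → suc a < b → b ≤ len q →
                vert q a ≢ vert q b × ¬ Adj (vert q a) (vert q b)
    far-apart q {a} {b} a+1<b b≤ =
      (λ eq → <⇒≢ a<b (injective q a≤ b≤ eq)) , (λ a∼b → [ a≢b+1 , b≢a+1 ]′ (chordless q a≤ b≤ a∼b))
      where
        a<b = <⇒≤ a+1<b
        a≤ = ≤-trans (<⇒≤ a<b) b≤
        a≢b+1 : a ≢ suc b
        a≢b+1 refl = <⇒≱ a+1<b (m≤n+m b 2)
        b≢a+1 : b ≢ suc a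
        b≢a+1 refl = <⇒≢ a+1<b refl

  chordless-path : ∀ {U u v} → InducedPath U u v → ChordlessPath G u v
  chordless-path q = record
    { len = len q ; vert = vert q ∘ toℕ ; start = start q
    ; end = trans (cong (vert q) (toℕ-fromℕ (len q))) (end q)
    ; inj = λ i j eq → toℕ-injective (injective q (bound i) (bound j) eq)
    ; induced = λ i j → mk⇔ (chordless q (bound i) (bound j)) (consecutive i j) }
    where
      bound : (i : Fin (suc (len q))) → toℕ i ≤ len q
      bound i = ≤-pred (toℕ<n i)
      consecutive : ∀ i j → toℕ i ≡ suc (toℕ j) ⊎ toℕ j ≡ suc (toℕ i) →
                    Adj (vert q (toℕ i)) (vert q (toℕ j))
      consecutive i j (inj₁ eq) = subst (λ t → Adj (vert q t) _) (sym eq)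
                                        (adj-sym (edge q (toℕ j) (subst (_≤ len q) eq (bound i))))
      consecutive i j (inj₂ eq) = subst (Adj _ ∘ vert q) (sym eq)
                                        (edge q (toℕ i) (subst (_≤ len q) eq (bound j)))

  induced-path : ∀ {u v} → ChordlessPath G u v → InducedPath (λ _ → ⊤) u v
  induced-path P = record
    { len = P.len ; vert = P.vert ∘ clamp P.len ; start = P.start
    ; end = trans (cong P.vert (toℕ-injective (trans (toℕ-clamp ≤-refl) (sym (toℕ-fromℕ P.len))))) P.end
    ; inside = λ _ _ → tt
    ; injective = λ i≤ j≤ eq → trans (sym (toℕ-clamp i≤)) (trans (cong toℕ (P.inj _ _ eq)) (toℕ-clamp j≤))
    ; chordless = λ i≤ j≤ a → subst₂ (λ i j → i ≡ suc j ⊎ j ≡ suc i) (toℕ-clamp i≤) (toℕ-clamp j≤)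
                                     (Equivalence.to (P.induced _ _) a)
    ; edge = λ i i< → Equivalence.from (P.induced _ _)
                        (inj₂ (trans (toℕ-clamp i<) (cong suc (sym (toℕ-clamp (<⇒≤ i<)))))) }
    where module P = ChordlessPath P

  path-gap : ∀ {U u v} (q : InducedPath U u v) {S : Fin n → Set} → Decidable S → S u → S v →
             ∀ {k} → k ≤ len q → ¬ S (vert q k) →
             ∃₂ λ a b → suc a ≤ b × suc b ≤ len q × S (vert q a) × S (vert q (suc b)) ×
                        (∀ t → suc a ≤ t → t ≤ b → ¬ S (vert q t))
  path-gap q {S} S? Su Sv = gap (S? ∘ vert q) (subst S (sym (start q)) Su) (subst S (sym (end q)) Sv)

  walk? : ∀ {U : Fin n → Set} → Decidable U → ∀ k u v → Dec (Walk U u v k)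
  walk? U? zero u v =
    map′ (λ { (p , refl) → stop p }) (λ { (stop p) → p , refl }) (U? u ×-dec u ≟ᶠ v)
  walk? U? (suc k) u v =
    map′ (λ { (p , w , u∼w , rest) → step p u∼w rest }) (λ { (step p u∼w rest) → p , _ , u∼w , rest })
         (U? u ×-dec any? λ w → adj? u w ×-dec walk? U? k w v)

  -- Induced paths have fewer than n edges, so only walks of length < n need to be searched.
  reach? : ∀ {U : Fin n → Set} → Decidable U → ∀ u v → Dec (Reach U u v)
  reach? {U} U? u v with any? {P = λ k → Walk U u v (toℕ k)} (λ k → walk? U? (toℕ k) u v)
  ... | yes (k , w) = yes (toℕ k , w)
  ... | no none = no λ r → let q = reach⇒path r in
    none (fromℕ< (len<n q) , subst (Walk U u v) (sym (toℕ-fromℕ< (len<n q))) (proj₂ (path⇒reach q (inside q))))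

  connected⇒reach : Connected G → ∀ u v → Reach (λ _ → ⊤) u v
  connected⇒reach connected u v = Path.len p , subst₂ (λ a b → Walk _ a b (Path.len p)) (Path.start p) (Path.end p)
                                                      (walk (Path.vert p) (Path.step p))
    where
      p = connected u v
      walk : ∀ {L} (x : Fin (suc L) → Fin n) → (∀ i → Adj (x (inject₁ i)) (x (fsuc i))) →
             Walk (λ _ → ⊤) (x fzero) (x (fromℕ L)) L
      walk {zero}  x x∼ = stop tt
      walk {suc L} x x∼ = step tt (x∼ fzero) (walk (x ∘ fsuc) (x∼ ∘ fsuc))

  -- Convexity and closure

  convex-path : ∀ {C U u v} → Convex G C → u ∈ C → v ∈ C → (q : InducedPath U u v) →
                ∀ i → i ≤ len q → vert q i ∈ C
  convex-path {C} C-convex u∈ v∈ q i i≤ =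
    subst (λ t → vert q t ∈ C) (toℕ-clamp i≤) (C-convex _ _ u∈ v∈ (chordless-path q) (clamp (len q) i))

  convex-connected : Connected G → ∀ {C} → Convex G C → ∀ {c c′} → c ∈ C → c′ ∈ C → Reach (_∈ C) c c′
  convex-connected connected C-convex c∈ c′∈ = path⇒reach q (convex-path C-convex c∈ c′∈ q)
    where q = reach⇒path (connected⇒reach connected _ _)

  cl-extensive : ∀ {X : VSet n} {x} → X x → cl G X x
  cl-extensive x∈X C _ X⊆C = X⊆C _ x∈X

  cl-mono : ∀ {X Y : VSet n} → (∀ {x} → X x → Y x) → ∀ {v} → cl G X v → cl G Y v
  cl-mono X⊆Y v∈ C C-convex Y⊆C = v∈ C C-convex (λ x x∈X → Y⊆C x (X⊆Y x∈X))

  cl-convex : ∀ {X : VSet n} {u v} → cl G X u → cl G X v → (P : ChordlessPath G u v) →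
              ∀ i → cl G X (ChordlessPath.vert P i)
  cl-convex u∈ v∈ P i C C-convex X⊆C = C-convex _ _ (u∈ C C-convex X⊆C) (v∈ C C-convex X⊆C) P i

  -- w ∈ cl{x, y}, in a form that transfers to every closure containing x and y.
  InHull : Fin n → Fin n → Fin n → Set₁
  InHull x y w = ∀ X → cl G X x → cl G X y → cl G X w

  path-hull : ∀ {U x y} (q : InducedPath U x y) → ∀ i → i ≤ len q → InHull x y (vert q i)
  path-hull q i i≤ X x∈ y∈ C C-convex X⊆C = convex-path C-convex (x∈ C C-convex X⊆C) (y∈ C C-convex X⊆C) q i i≤

  -- The second vertex of an induced path from x to y.
  interior-vertex : ∀ {W : Fin n → Set} {x y} → x ≢ y → ¬ Adj x y →
                    Reach (λ w → w ≡ x ⊎ W w ⊎ w ≡ y) x y → ∃ λ w → W w × Adj x w × InHull x y w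
  interior-vertex {W} {x} {y} x≢y x≁y r = second (inside q 1 1≤len)
    where
      q = reach⇒path r
      2≤len = nonadjacent-ends⇒2≤len q x≢y x≁y
      1≤len = <⇒≤ 2≤len
      second : vert q 1 ≡ x ⊎ W (vert q 1) ⊎ vert q 1 ≡ y → ∃ λ w → W w × Adj x w × InHull x y w
      second (inj₁ ≡x)        = contradiction (injective q 1≤len z≤n (trans ≡x (sym (start q)))) λ ()
      second (inj₂ (inj₂ ≡y)) = contradiction (injective q 1≤len ≤-refl (trans ≡y (sym (end q)))) (<⇒≢ 2≤len)
      second (inj₂ (inj₁ w))  =
        vert q 1 , w , subst (λ z → Adj z (vert q 1)) (start q) (edge q 0 1≤len) , path-hull q 1 1≤len

  detour : ∀ {W : Fin n → Set} {x w w′ y} → Adj x w → Reach W w w′ → Adj w′ y →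
           Reach (λ z → z ≡ x ⊎ W z ⊎ z ≡ y) x y
  detour x∼w r w′∼y = reach-cons (inj₁ refl) x∼w (reach-snoc (reach-map (inj₂ ∘ inj₁) r) w′∼y (inj₂ (inj₂ refl)))

  -- C is convex iff it has no excursion. As its middle part is a walk, an excursion can be searched
  -- for, which makes convexity and closure decidable.
  Excursion : Subset n → Set
  Excursion C = ∃₂ λ s t → s ∈ C × t ∈ C × s ≢ t × ¬ Adj s t ×
                ∃₂ λ w w′ → Adj s w × Adj w′ t × Reach (_∉ C) w w′

  excursion? : ∀ C → Dec (Excursion C)
  excursion? C = any? λ s → any? λ t → s ∈? C ×-dec t ∈? C ×-dec ¬? (s ≟ᶠ t) ×-dec ¬? (adj? s t) ×-dec
                 any? λ w → any? λ w′ → adj? s w ×-dec adj? w′ t ×-dec reach? (λ x → ¬? (x ∈? C)) w w′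

  excursion-reverse : ∀ {C} → Excursion C → Excursion C
  excursion-reverse (s , t , s∈ , t∈ , s≢t , s≁t , w , w′ , s∼w , w′∼t , r) =
    t , s , t∈ , s∈ , s≢t ∘ sym , s≁t ∘ adj-sym , w′ , w , adj-sym w′∼t , adj-sym s∼w , reach-reverse r

  excursion-exit : ∀ {C} ((s , t , _) : Excursion C) → ∃ λ w → w ∉ C × Adj s w × InHull s t w
  excursion-exit (_ , _ , _ , _ , s≢t , s≁t , _ , _ , s∼w , w′∼t , r) = interior-vertex s≢t s≁t (detour s∼w r w′∼t)

  excursion⇒¬convex : ∀ {C} → Excursion C → ¬ Convex G C
  excursion⇒¬convex {C} e@(_ , _ , s∈ , t∈ , _) C-convex with excursion-exit e
  ... | w , w∉ , _ , hull = w∉ (hull ⟦ C ⟧ (cl-extensive s∈) (cl-extensive t∈) C C-convex λ _ x∈ → x∈)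

  excursion-free⇒convex : ∀ {C} → ¬ Excursion C → Convex G C
  excursion-free⇒convex {C} no-excursion u v u∈ v∈ P i =
    decidable-stable (_ ∈? C) λ i∉ → no-excursion (excursion i∉)
    where
      q = induced-path P
      excursion : ChordlessPath.vert P i ∉ C → Excursion C
      excursion i∉
        with path-gap q (_∈? C) u∈ v∈ (≤-pred (toℕ<n i)) (i∉ ∘ subst (_∈ C) (cong (ChordlessPath.vert P) (clamp-toℕ i)))
      ... | a , b , a+1≤b , b+1≤ , a∈ , b+1∈ , between =
        vert q a , vert q (suc b) , a∈ , b+1∈ , proj₁ apart , proj₂ apart ,
        vert q (suc a) , vert q b , edge q a (≤-trans a+1≤b (<⇒≤ b+1≤)) , edge q b b+1≤ ,
        (b ∸ suc a , segment q a+1≤b (<⇒≤ b+1≤) between)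
        where apart = far-apart q (s≤s a+1≤b) b+1≤

  convex? : ∀ C → Dec (Convex G C)
  convex? C with excursion? C
  ... | yes e  = no (excursion⇒¬convex e)
  ... | no ¬e = yes (excursion-free⇒convex ¬e)

  cl? : ∀ {X : VSet n} → Decidable X → Decidable (cl G X)
  cl? X? v with anySubset? (λ C → convex? C ×-dec all? (λ x → X? x →-dec x ∈? C) ×-dec ¬? (v ∈? C))
  ... | yes (C , C-convex , X⊆C , v∉C) = no λ v∈ → v∉C (v∈ C C-convex X⊆C)
  ... | no none = yes λ C C-convex X⊆C → decidable-stable (v ∈? C) λ v∉C → none (C , C-convex , X⊆C , v∉C)

  singleton-convex : ∀ v → Convex G ⁅ v ⁆
  singleton-convex v x y x∈ y∈ P = go P.len P.vert P.inj P.start P.end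
    where
      module P = ChordlessPath P
      go : ∀ L (vt : Fin (suc L) → Fin n) → (∀ i j → vt i ≡ vt j → i ≡ j) →
           vt fzero ≡ x → vt (fromℕ L) ≡ y → ∀ i → vt i ∈ ⁅ v ⁆
      go zero    vt _      vt₀≡x _     fzero = subst (_∈ ⁅ v ⁆) (sym vt₀≡x) x∈
      go (suc L) vt vt-inj vt₀≡x vtL≡y i with vt-inj fzero (fromℕ (suc L))
        (trans vt₀≡x (trans (x∈⁅y⁆⇒x≡y v x∈) (sym (trans vtL≡y (x∈⁅y⁆⇒x≡y v y∈)))))
      ... | ()

  hull-meets-convex : Connected G → ∀ {C} → Convex G C → ∀ {x y c c′} → x ≢ y → ¬ Adj x y →
                      c ∈ C → Adj x c → c′ ∈ C → Adj c′ y → ∃ λ w → w ∈ C × InHull x y w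
  hull-meets-convex connected C-convex x≢y x≁y c∈ x∼c c′∈ c′∼y =
    let w , w∈ , _ , hull = interior-vertex x≢y x≁y (detour x∼c (convex-connected connected C-convex c∈ c′∈) c′∼y)
    in w , w∈ , hull

  -- Otherwise cl Y ∖ Z is convex: an excursion of it starts and ends at non-adjacent vertices of N(Z).
  cl∩N-nonclique : ∀ {Y Z : Subset n} → (∀ {y} → y ∈ Y → y ∉ Z) → ∀ {z} → z ∈ Z → cl G ⟦ Y ⟧ z →
                   ¬ Clique G (λ w → cl G ⟦ Y ⟧ w × N G ⟦ Z ⟧ w)
  cl∩N-nonclique {Y} {Z} Y∩Z≡∅ z∈Z z∈clY clique =
    proj₂ (∈-subset⁻ E? (z∈clY E E-convex λ _ y∈ → ∈-subset⁺ E? (cl-extensive y∈ , Y∩Z≡∅ y∈))) z∈Z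
    where
      E? : Decidable (λ w → cl G ⟦ Y ⟧ w × w ∉ Z)
      E? w = cl? (_∈? Y) w ×-dec ¬? (w ∈? Z)
      E = subset E?
      frontier : ((s , t , _) : Excursion E) → cl G ⟦ Y ⟧ s × N G ⟦ Z ⟧ s
      frontier e@(_ , _ , s∈ , t∈ , _) =
        let w , w∉E , s∼w , hull = excursion-exit e
            s∈clY , s∉Z = ∈-subset⁻ E? s∈
            w∈clY = hull ⟦ Y ⟧ s∈clY (proj₁ (∈-subset⁻ E? t∈))
        in s∈clY , s∉Z , w , decidable-stable (w ∈? Z) (λ w∉Z → w∉E (∈-subset⁺ E? (w∈clY , w∉Z))) , s∼w
      E-convex : Convex G E
      E-convex = excursion-free⇒convex λ e@(s , t , _ , _ , s≢t , s≁t , _) →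
        s≁t (clique s t (frontier e) (frontier (excursion-reverse e)) s≢t)

  -- Saturated pairs

  record SaturatedSide (P Q : Subset n) : Set where
    field
      convex  : Convex G P
      absorbs : ∀ {v} → (_/_ G ⟦ P ⟧ ⟦ Q ⟧) v → v ∈ P

  -- Only the first stage σ(P,Q) ⊆ S(P,Q) of the saturation is needed.
  saturated-side : ∀ {P Q : Subset n} → (∀ v → ⟦ P ⟧ v ⇔ S G ⟦ P ⟧ ⟦ Q ⟧ v) → SaturatedSide P Q
  saturated-side {P} {Q} P⇔S = record { convex = convex ; absorbs = σ⊆P ∘ cl-extensive ∘ inj₁ }
    where
      σ⊆P : ∀ {v} → σ G ⟦ P ⟧ ⟦ Q ⟧ v → v ∈ P
      σ⊆P v∈σ = Equivalence.from (P⇔S _) (0 , v∈σ)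
      P⊆σ : ∀ {v} → v ∈ P → σ G ⟦ P ⟧ ⟦ Q ⟧ v
      P⊆σ v∈ = cl-extensive (inj₁ (_ , v∈ , cl-extensive (inj₂ refl)))
      convex : Convex G P
      convex u v u∈ v∈ path i = σ⊆P (cl-convex (P⊆σ u∈) (P⊆σ v∈) path i)

  -- Otherwise an induced path x, p, …, p₀, q₀ puts a vertex of P into cl(Q ∪ {x}).
  other-side-neighbour : Connected G → ∀ {P Q : Subset n} → SaturatedSide P Q →
                         ∀ {p₀ q₀} → p₀ ∈ P → q₀ ∈ Q → Adj p₀ q₀ →
                         ∀ {x p} → x ∉ P → x ∉ Q → p ∈ P → Adj x p → ∃ λ q → q ∈ Q × Adj x q
  other-side-neighbour connected {Q = Q} P-side {q₀ = q₀} p₀∈ q₀∈ p₀∼q₀ {x} x∉P x∉Q p∈ x∼p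
    with adj? x q₀
  ... | yes x∼q₀ = q₀ , q₀∈ , x∼q₀
  ... | no x≁q₀ =
    let w , w∈P , hull = hull-meets-convex connected (SaturatedSide.convex P-side) (λ { refl → x∉Q q₀∈ })
                                           x≁q₀ p∈ x∼p p₀∈ p₀∼q₀
    in contradiction (SaturatedSide.absorbs P-side
                       (w , w∈P , hull (_∪′_ G ⟦ Q ⟧ (_≡ x)) (cl-extensive (inj₂ refl)) (cl-extensive (inj₁ q₀∈))))
                     x∉P

  module Separation (connected : Connected G) {A B : Subset n}
                    (A-side : SaturatedSide A B) (B-side : SaturatedSide B A)
                    {a₀ b₀ : Fin n} (a₀∈ : a₀ ∈ A) (b₀∈ : b₀ ∈ B) (a₀∼b₀ : Adj a₀ b₀) where

    open SaturatedSide

    Outside : Fin n → Set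
    Outside w = w ∉ A ∪ B

    outside-A : ∀ {w} → Outside w → w ∉ A
    outside-A w∉ = w∉ ∘ x∈p∪q⁺ ∘ inj₁

    outside-B : ∀ {w} → Outside w → w ∉ B
    outside-B w∉ = w∉ ∘ x∈p∪q⁺ ∘ inj₂

    outside⁻ : ∀ {w} → Outside w → w ∉ A × w ∉ B
    outside⁻ w∉ = outside-A w∉ , outside-B w∉

    outside⁺ : ∀ {w} → w ∉ A × w ∉ B → Outside w
    outside⁺ (w∉A , w∉B) w∈ = [ w∉A , w∉B ]′ (x∈p∪q⁻ A B w∈)

    Touches : Fin n → Set
    Touches w = ∃ λ z → z ∈ A ∪ B × Adj w z

    Boundary : Fin n → Set
    Boundary = N G ⟦ A ∪ B ⟧

    Inner : Fin n → Set
    Inner w = Outside w × ¬ Touches w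

    touches? : Decidable Touches
    touches? w = any? λ z → z ∈? A ∪ B ×-dec adj? w z

    boundary? : Decidable Boundary
    boundary? w = ¬? (w ∈? A ∪ B) ×-dec touches? w

    inner? : Decidable Inner
    inner? w = ¬? (w ∈? A ∪ B) ×-dec ¬? (touches? w)

    boundary-or-inner : ∀ {w} → Outside w → Boundary w ⊎ Inner w
    boundary-or-inner {w} w∉ with touches? w
    ... | yes t  = inj₁ (w∉ , t)
    ... | no ¬t = inj₂ (w∉ , ¬t)

    boundary-sees-both : ∀ {x} → Boundary x → (∃ λ a → a ∈ A × Adj x a) × (∃ λ b → b ∈ B × Adj x b)
    boundary-sees-both (x∉ , z , z∈ , x∼z) with x∈p∪q⁻ A B z∈
    ... | inj₁ z∈A =
      (z , z∈A , x∼z) ,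
      other-side-neighbour connected A-side a₀∈ b₀∈ a₀∼b₀ (outside-A x∉) (outside-B x∉) z∈A x∼z
    ... | inj₂ z∈B =
      other-side-neighbour connected B-side b₀∈ a₀∈ (adj-sym a₀∼b₀) (outside-B x∉) (outside-A x∉) z∈B x∼z ,
      (z , z∈B , x∼z)

    boundary-hull-meets-A : ∀ {x y} → Boundary x → Boundary y → x ≢ y → ¬ Adj x y →
                            ∃ λ a → a ∈ A × InHull x y a
    boundary-hull-meets-A ∂x ∂y x≢y x≁y with boundary-sees-both ∂x | boundary-sees-both ∂y
    ... | (a , a∈ , x∼a) , _ | (a′ , a′∈ , y∼a′) , _ =
      hull-meets-convex connected (convex A-side) x≢y x≁y a∈ x∼a a′∈ (adj-sym y∼a′)

    boundary-hull-meets-B : ∀ {x y} → Boundary x → Boundary y → x ≢ y → ¬ Adj x y →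
                            ∃ λ b → b ∈ B × InHull x y b
    boundary-hull-meets-B ∂x ∂y x≢y x≁y with boundary-sees-both ∂x | boundary-sees-both ∂y
    ... | _ , (b , b∈ , x∼b) | _ , (b′ , b′∈ , y∼b′) =
      hull-meets-convex connected (convex B-side) x≢y x≁y b∈ x∼b b′∈ (adj-sym y∼b′)

    -- Empty unless x itself is inner.
    Cell : Fin n → Fin n → Set
    Cell x = Reach Inner x

    cell? : ∀ x → Decidable (Cell x)
    cell? = reach? inner?

    Attached : Fin n → Fin n → Set
    Attached x m = Boundary m × (m ≡ x ⊎ ∃ λ c → Cell x c × Adj c m)

    attached? : ∀ x → Decidable (Attached x)
    attached? x m = boundary? m ×-dec (m ≟ᶠ x ⊎-dec any? λ c → cell? x c ×-dec adj? c m)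

    inner-boundary-disjoint : ∀ {w} → Inner w → ¬ Boundary w
    inner-boundary-disjoint (_ , ¬t) (_ , t) = ¬t t

    -- On an induced path b, m, c, …, x from a B-neighbour b of m, the vertex after b can only be m.
    attached∈cl : ∀ {x m} → Attached x m → cl G (_∪′_ G ⟦ B ⟧ (_≡ x)) m
    attached∈cl (_ , inj₁ refl) = cl-extensive (inj₂ refl)
    attached∈cl {x} {m} (∂m , inj₂ (_ , x⇝c , c∼m)) = absorbed (proj₂ (boundary-sees-both ∂m))
      where
        inner-x = reach-head x⇝c
        absorbed : (∃ λ b → b ∈ B × Adj m b) → cl G (_∪′_ G ⟦ B ⟧ (_≡ x)) m
        absorbed (b , b∈ , m∼b) =
          neighbour-is-m (interior-vertex {W = λ w → Inner w ⊎ w ≡ m}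
                                          (λ { refl → proj₁ inner-x (x∈p∪q⁺ (inj₂ b∈)) })
                                          (λ b∼x → proj₂ inner-x (b , x∈p∪q⁺ (inj₂ b∈) , adj-sym b∼x))
                                          (reach-cons (inj₁ refl) (adj-sym m∼b)
                                            (reach-cons (inj₂ (inj₁ (inj₂ refl))) (adj-sym c∼m)
                                              (reach-map (inj₂ ∘ inj₁ ∘ inj₁) (reach-reverse x⇝c)))))
          where
            neighbour-is-m : (∃ λ w → (Inner w ⊎ w ≡ m) × Adj b w × InHull b x w) → cl G (_∪′_ G ⟦ B ⟧ (_≡ x)) m
            neighbour-is-m (w , inj₁ inner-w , b∼w , _) =
              contradiction (b , x∈p∪q⁺ (inj₂ b∈) , adj-sym b∼w) (proj₂ inner-w)
            neighbour-is-m (w , inj₂ w≡m , _ , hull) =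
              subst (cl G _) w≡m (hull (_∪′_ G ⟦ B ⟧ (_≡ x)) (cl-extensive (inj₁ b∈)) (cl-extensive (inj₂ refl)))

    attachments-adjacent : ∀ {x m m′} → Outside x → Attached x m → Attached x m′ → m ≢ m′ → Adj m m′
    attachments-adjacent x∉ at at′ m≢m′ = decidable-stable (adj? _ _) λ m≁m′ →
      let a , a∈ , hull = boundary-hull-meets-A (proj₁ at) (proj₁ at′) m≢m′ m≁m′ in
      outside-A x∉ (absorbs A-side (a , a∈ , hull (_∪′_ G ⟦ B ⟧ (_≡ _)) (attached∈cl at) (attached∈cl at′)))

    Route : Fin n → Fin n → Fin n → Fin n → Fin n → Set
    Route x y m m′ w = Cell x w ⊎ w ≡ m ⊎ w ∈ A ⊎ w ≡ m′ ⊎ Cell y w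

    route : ∀ {x y c m m′} → Cell x c → Adj c m → Boundary m → Attached y m′ → Reach (Route x y m m′) x y
    route {x} {y} {_} {m} {m′} x⇝c c∼m ∂m (∂m′ , m′-side) = reach-++ x⇝m (reach-++ m⇝m′ (m′⇝y m′-side))
      where
        x⇝m : Reach (Route x y m m′) x m
        x⇝m = reach-snoc (reach-map inj₁ (reach-along x⇝c)) c∼m (inj₂ (inj₁ refl))
        m⇝m′ : Reach (Route x y m m′) m m′
        m⇝m′ =
          let a , a∈ , m∼a = proj₁ (boundary-sees-both ∂m)
              a′ , a′∈ , m′∼a′ = proj₁ (boundary-sees-both ∂m′)
          in reach-map [ inj₂ ∘ inj₁ , [ inj₂ ∘ inj₂ ∘ inj₁ , inj₂ ∘ inj₂ ∘ inj₂ ∘ inj₁ ]′ ]′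
                       (detour m∼a (convex-connected connected (convex A-side) a∈ a′∈) (adj-sym m′∼a′))
        m′⇝y : (m′ ≡ y ⊎ ∃ λ c′ → Cell y c′ × Adj c′ m′) → Reach (Route x y m m′) m′ y
        m′⇝y (inj₁ m′≡y) = subst (Reach _ m′) m′≡y (reach-here (inj₂ (inj₂ (inj₂ (inj₁ refl)))))
        m′⇝y (inj₂ (c′ , y⇝c′ , c′∼m′)) =
          reach-cons (inj₂ (inj₂ (inj₂ (inj₁ refl)))) (adj-sym c′∼m′)
            (reach-map (inj₂ ∘ inj₂ ∘ inj₂ ∘ inj₂) (reach-reverse (reach-along y⇝c′)))

    -- On an induced route from x to y, the first vertex outside the cell of x can only be m.
    attached∈hull : ∀ {x y m m′} → Outside x → Attached x m → Attached y m′ → m ≢ m′ → ¬ Adj m m′ →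
                    InHull x y m
    attached∈hull _ (_ , inj₁ refl) _ _ _ _ x∈ _ = x∈
    attached∈hull {x} {y} {m} {m′} x∉ at@(∂m , inj₂ (_ , x⇝c , c∼m)) at′@(∂m′ , m′-side) m≢m′ m≁m′ =
      leave-cell (crossing (cell? x ∘ vert q) (subst (Cell x) (sym (start q)) (reach-here (reach-head x⇝c)))
                                              (y∉cell m′-side ∘ subst (Cell x) (end q)))
      where
        q = reach⇒path (route x⇝c c∼m ∂m at′)
        m′-unattached : ¬ Attached x m′
        m′-unattached at-x = m≁m′ (attachments-adjacent x∉ at at-x m≢m′)
        y∉cell : (m′ ≡ y ⊎ ∃ λ c′ → Cell y c′ × Adj c′ m′) → ¬ Cell x y
        y∉cell (inj₁ m′≡y) x⇝y = inner-boundary-disjoint (reach-last x⇝y) (subst Boundary m′≡y ∂m′)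
        y∉cell (inj₂ (c′ , y⇝c′ , c′∼m′)) x⇝y = m′-unattached (∂m′ , inj₂ (c′ , reach-++ x⇝y y⇝c′ , c′∼m′))
        leave-cell : (∃ λ b → suc b ≤ len q × Cell x (vert q b) × ¬ Cell x (vert q (suc b))) → InHull x y m
        leave-cell (b , b<len , x⇝b , b+1∉cell) = classify (inside q (suc b) b<len)
          where
            b∼b+1 = edge q b b<len
            classify : Route x y m m′ (vert q (suc b)) → InHull x y m
            classify (inj₁ x⇝b+1) = contradiction x⇝b+1 b+1∉cell
            classify (inj₂ (inj₁ ≡m)) = subst (InHull x y) ≡m (path-hull q (suc b) b<len)
            classify (inj₂ (inj₂ (inj₁ ∈A))) = contradiction (_ , x∈p∪q⁺ (inj₁ ∈A) , b∼b+1) (proj₂ (reach-last x⇝b))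
            classify (inj₂ (inj₂ (inj₂ (inj₁ ≡m′)))) =
              contradiction (∂m′ , inj₂ (_ , x⇝b , subst (Adj _) ≡m′ b∼b+1)) m′-unattached
            classify (inj₂ (inj₂ (inj₂ (inj₂ y⇝b+1)))) =
              contradiction (reach-snoc x⇝b b∼b+1 (reach-last y⇝b+1)) b+1∉cell

    pair : Fin n → Fin n → Subset n
    pair u v = ⁅ u ⁆ ∪ ⁅ v ⁆

    ∈-pairˡ : ∀ {u v} → u ∈ pair u v
    ∈-pairˡ {u} = x∈p∪q⁺ (inj₁ (x∈⁅x⁆ u))

    ∈-pairʳ : ∀ {u v} → v ∈ pair u v
    ∈-pairʳ {u} {v} = x∈p∪q⁺ {p = ⁅ u ⁆} (inj₂ (x∈⁅x⁆ v))

    ∈-pair⁻ : ∀ {u v w} → w ∈ pair u v → w ≡ u ⊎ w ≡ v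
    ∈-pair⁻ {u} {v} w∈ = Data.Sum.map (x∈⁅y⁆⇒x≡y u) (x∈⁅y⁆⇒x≡y v) (x∈p∪q⁻ ⁅ u ⁆ ⁅ v ⁆ w∈)

    pair-⊆ : ∀ {u v X} → u ∈ X → v ∈ X → pair u v ⊆ X
    pair-⊆ u∈ v∈ w∈ with ∈-pair⁻ w∈
    ... | inj₁ refl = u∈
    ... | inj₂ refl = v∈

    HullMeetsA : Fin n → Fin n → Set
    HullMeetsA u v = ∃ λ a → a ∈ A × cl G ⟦ pair u v ⟧ a

    pair-meets-A? : ∀ X → Dec (∃₂ λ u v → u ∈ X × v ∈ X × HullMeetsA u v)
    pair-meets-A? X = any? λ u → any? λ v → u ∈? X ×-dec v ∈? X ×-dec any? λ a → a ∈? A ×-dec cl? (_∈? pair u v) a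

    module Region {X : Subset n} (X-outside : ∀ {x} → x ∈ X → Outside x) where

      InRegion : Fin n → Set
      InRegion w = ∃ λ x → x ∈ X × (Cell x w ⊎ Attached x w)

      inRegion? : Decidable InRegion
      inRegion? w = any? λ x → x ∈? X ×-dec (cell? x w ⊎-dec attached? x w)

      region : Subset n
      region = subset inRegion?

      X⊆region : X ⊆ region
      X⊆region {x} x∈ = ∈-subset⁺ inRegion? (x , x∈ , [ inj₂ ∘ (_, inj₁ refl) , inj₁ ∘ reach-here ]′
                                                          (boundary-or-inner (X-outside x∈)))

      region-outside : ∀ {w} → w ∈ region → Outside w
      region-outside w∈ with ∈-subset⁻ inRegion? w∈
      ... | _ , _ , inj₁ x⇝w = proj₁ (reach-last x⇝w)
      ... | _ , _ , inj₂ at  = proj₁ (proj₁ at)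

      cell-interior : ∀ {x w w′} → x ∈ X → Cell x w → Adj w w′ → w′ ∈ region
      cell-interior {x} {w} {w′} x∈ x⇝w w∼w′ with w′ ∈? A ∪ B
      ... | yes w′∈ = contradiction (w′ , w′∈ , w∼w′) (proj₂ (reach-last x⇝w))
      ... | no w′∉ = ∈-subset⁺ inRegion? (x , x∈ , [ (λ ∂w′ → inj₂ (∂w′ , inj₂ (w , x⇝w , w∼w′))) ,
                                                      inj₁ ∘ reach-snoc x⇝w w∼w′ ]′ (boundary-or-inner w′∉))

      leaving-region : ∀ {w w′} → w ∈ region → Adj w w′ → w′ ∉ region → ∃ λ x → x ∈ X × Attached x w
      leaving-region w∈ w∼w′ w′∉ with ∈-subset⁻ inRegion? w∈
      ... | x , x∈ , inj₁ x⇝w = contradiction (cell-interior x∈ x⇝w w∼w′) w′∉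
      ... | x , x∈ , inj₂ at  = x , x∈ , at

      region-convex : ¬ (∃₂ λ u v → u ∈ X × v ∈ X × HullMeetsA u v) → Convex G region
      region-convex none = excursion-free⇒convex λ (_ , _ , s∈ , t∈ , s≢t , s≁t , _ , _ , s∼w , w′∼t , r) →
        let x , x∈ , at-s = leaving-region s∈ s∼w (reach-head r)
            y , y∈ , at-t = leaving-region t∈ (adj-sym w′∼t) (reach-last r)
            a , a∈ , hull = boundary-hull-meets-A (proj₁ at-s) (proj₁ at-t) s≢t s≁t
            x∈cl = cl-extensive ∈-pairˡ
            y∈cl = cl-extensive ∈-pairʳ
        in none (x , y , x∈ , y∈ , a , a∈ ,
                 hull _ (attached∈hull (X-outside x∈) at-s at-t s≢t s≁t _ x∈cl y∈cl)
                        (attached∈hull (X-outside y∈) at-t at-s (s≢t ∘ sym) (s≁t ∘ adj-sym) _ y∈cl x∈cl))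

    cl-meets-A⇒pair-meets-A : ∀ {X : Subset n} → (∀ {x} → x ∈ X → Outside x) → ∀ {a} → a ∈ A → cl G ⟦ X ⟧ a →
                              ∃₂ λ u v → u ∈ X × v ∈ X × HullMeetsA u v
    cl-meets-A⇒pair-meets-A {X} X-outside a∈ a∈cl = decidable-stable (pair-meets-A? X) λ none →
      outside-A (region-outside (a∈cl region (region-convex none) λ _ → X⊆region)) a∈
      where open Region X-outside

    Trace : Fin n → Fin n → VSet n
    Trace u v w = cl G ⟦ pair u v ⟧ w × N G ⟦ A ∪ B ⟧ w

    pair-outside : ∀ {u v} → Outside u → Outside v → ∀ {w} → w ∈ pair u v → Outside w
    pair-outside u∉ v∉ w∈ with ∈-pair⁻ w∈
    ... | inj₁ refl = u∉
    ... | inj₂ refl = v∉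

    nonclique-witness : ∀ {u v} → ¬ Clique G (Trace u v) →
                        ∃₂ λ x y → Trace u v x × Trace u v y × x ≢ y × ¬ Adj x y
    nonclique-witness {u} {v} nonclique = decidable-stable
      (any? λ x → any? λ y → trace? x ×-dec trace? y ×-dec ¬? (x ≟ᶠ y) ×-dec ¬? (adj? x y))
      λ none → nonclique λ x y x∈ y∈ x≢y → decidable-stable (adj? x y) λ x≁y → none (x , y , x∈ , y∈ , x≢y , x≁y)
      where
        trace? : Decidable (Trace u v)
        trace? w = cl? (_∈? pair u v) w ×-dec boundary? w

    cl-within-singleton : ∀ {Y : Subset n} {s w} → Y ⊆ ⁅ s ⁆ → cl G ⟦ Y ⟧ w → w ≡ s
    cl-within-singleton {s = s} Y⊆ w∈ = x∈⁅y⁆⇒x≡y s (w∈ ⁅ s ⁆ (singleton-convex s) λ _ → Y⊆)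

    proper-subset-of-pair : ∀ {Y u v} → Y ⊂ pair u v → Y ⊆ ⁅ u ⁆ ⊎ Y ⊆ ⁅ v ⁆
    proper-subset-of-pair {u = u} {v} (Y⊆ , t , t∈ , t∉Y) with ∈-pair⁻ t∈
    ... | inj₁ refl = inj₂ λ w∈ → [ (λ { refl → contradiction w∈ t∉Y }) , (λ { refl → x∈⁅x⁆ v }) ]′ (∈-pair⁻ (Y⊆ w∈))
    ... | inj₂ refl = inj₁ λ w∈ → [ (λ { refl → x∈⁅x⁆ u }) , (λ { refl → contradiction w∈ t∉Y }) ]′ (∈-pair⁻ (Y⊆ w∈))

    nonclique⇒mfs : ∀ {u v} → Outside u → Outside v → ¬ Clique G (Trace u v) → MFS G ⟦ A ⟧ ⟦ B ⟧ (pair u v)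
    nonclique⇒mfs {u} {v} u∉ v∉ nonclique =
      let x , y , (x∈ , ∂x) , (y∈ , ∂y) , x≢y , x≁y = nonclique-witness nonclique
          a , a∈ , a∈hull = boundary-hull-meets-A ∂x ∂y x≢y x≁y
          b , b∈ , b∈hull = boundary-hull-meets-B ∂x ∂y x≢y x≁y
      in ((λ _ w∈ → outside⁻ (pair-outside u∉ v∉ w∈)) ,
          (a , a∈ , a∈hull ⟦ pair u v ⟧ x∈ y∈) , (b , b∈ , b∈hull ⟦ pair u v ⟧ x∈ y∈)) ,
         minimal
      where
        minimal : ∀ Y → Y ⊂ pair u v → ¬ Forbidden G ⟦ A ⟧ ⟦ B ⟧ Y
        minimal Y Y⊂ (_ , (a′ , a′∈ , a′∈cl) , _) with proper-subset-of-pair Y⊂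
        ... | inj₁ Y⊆u = outside-A u∉ (subst (_∈ A) (cl-within-singleton Y⊆u a′∈cl) a′∈)
        ... | inj₂ Y⊆v = outside-A v∉ (subst (_∈ A) (cl-within-singleton Y⊆v a′∈cl) a′∈)

    forbidden⇒nonclique-pair : ∀ {X} → Forbidden G ⟦ A ⟧ ⟦ B ⟧ X →
                               ∃₂ λ u v → u ∈ X × v ∈ X × Outside u × Outside v × ¬ Clique G (Trace u v)
    forbidden⇒nonclique-pair {X} (X-out , (a , a∈ , a∈cl) , _) =
      let u , v , u∈ , v∈ , a′ , a′∈ , a′∈cl = cl-meets-A⇒pair-meets-A {X} X-outside a∈ a∈cl
      in u , v , u∈ , v∈ , X-outside u∈ , X-outside v∈ ,
         cl∩N-nonclique (pair-outside (X-outside u∈) (X-outside v∈)) (x∈p∪q⁺ (inj₁ a′∈)) a′∈cl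
      where
        X-outside : ∀ {x} → x ∈ X → Outside x
        X-outside x∈ = outside⁺ (X-out _ x∈)

    mfs⇔nonclique-pair : ∀ X → MFS G ⟦ A ⟧ ⟦ B ⟧ X ⇔
                         (∃₂ λ u v → X ≡ pair u v × Outside u × Outside v × ¬ Clique G (Trace u v))
    mfs⇔nonclique-pair X = mk⇔ to from
      where
        to : MFS G ⟦ A ⟧ ⟦ B ⟧ X → ∃₂ λ u v → X ≡ pair u v × Outside u × Outside v × ¬ Clique G (Trace u v)
        to (forbidden , minimal) =
          let u , v , u∈ , v∈ , u∉ , v∉ , nonclique = forbidden⇒nonclique-pair forbidden
              pair⊆X = pair-⊆ {X = X} u∈ v∈
              X⊆pair : X ⊆ pair u v
              X⊆pair {w} w∈ = decidable-stable (w ∈? pair u v) λ w∉ →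
                minimal (pair u v) (pair⊆X , w , w∈ , w∉) (proj₁ (nonclique⇒mfs u∉ v∉ nonclique))
          in u , v , ⊆-antisym X⊆pair pair⊆X , u∉ , v∉ , nonclique
        from : (∃₂ λ u v → X ≡ pair u v × Outside u × Outside v × ¬ Clique G (Trace u v)) → MFS G ⟦ A ⟧ ⟦ B ⟧ X
        from (u , v , X≡ , u∉ , v∉ , nonclique) = subst (MFS G ⟦ A ⟧ ⟦ B ⟧) (sym X≡) (nonclique⇒mfs u∉ v∉ nonclique)

    forbidden⇔contains-mfs : ∀ {X} → X ⊆ ∁ (A ∪ B) →
                             Forbidden G ⟦ A ⟧ ⟦ B ⟧ X ⇔ (∃ λ Y → MFS G ⟦ A ⟧ ⟦ B ⟧ Y × Y ⊆ X)
    forbidden⇔contains-mfs {X} X⊆ = mk⇔ to from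
      where
        to : Forbidden G ⟦ A ⟧ ⟦ B ⟧ X → ∃ λ Y → MFS G ⟦ A ⟧ ⟦ B ⟧ Y × Y ⊆ X
        to forbidden =
          let u , v , u∈ , v∈ , u∉ , v∉ , nonclique = forbidden⇒nonclique-pair forbidden
          in pair u v , nonclique⇒mfs u∉ v∉ nonclique , pair-⊆ u∈ v∈
        from : (∃ λ Y → MFS G ⟦ A ⟧ ⟦ B ⟧ Y × Y ⊆ X) → Forbidden G ⟦ A ⟧ ⟦ B ⟧ X
        from (Y , ((_ , (a , a∈ , a∈cl) , (b , b∈ , b∈cl)) , _) , Y⊆X) =
          (λ _ x∈ → outside⁻ (x∈∁p⇒x∉p (X⊆ x∈))) ,
          (a , a∈ , cl-mono Y⊆X a∈cl) , (b , b∈ , cl-mono Y⊆X b∈cl)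

lemma15 : ∀ {n : ℕ} (G : Graph n) → Connected G →
          (A B : Subset n) →
          Linked G ⟦ A ⟧ ⟦ B ⟧ → Disjoint G ⟦ A ⟧ ⟦ B ⟧ → Saturated G ⟦ A ⟧ ⟦ B ⟧ →
          (∀ (X : Subset n) →
             MFS G ⟦ A ⟧ ⟦ B ⟧ X ⇔
             (∃ λ u → ∃ λ v → X ≡ ⁅ u ⁆ ∪ ⁅ v ⁆ × u ∉ A ∪ B × v ∉ A ∪ B ×
                ¬ Clique G (λ w → cl G ⟦ ⁅ u ⁆ ∪ ⁅ v ⁆ ⟧ w × N G ⟦ A ∪ B ⟧ w)))
          ×
          (∀ (X : Subset n) → X ⊆ ∁ (A ∪ B) →
             Forbidden G ⟦ A ⟧ ⟦ B ⟧ X ⇔ (∃ λ Y → MFS G ⟦ A ⟧ ⟦ B ⟧ Y × Y ⊆ X))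
lemma15 G connected A B (_ , _ , a₀∈ , b₀∈ , a₀∼b₀) _ (A-saturated , B-saturated) =
  mfs⇔nonclique-pair , λ _ → forbidden⇔contains-mfs
  where
    open Separation G connected (saturated-side G A-saturated) (saturated-side G B-saturated) a₀∈ b₀∈ a₀∼b₀
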